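{- Let $\beta,\beta_1$ be elements of a commutative ring (e.g. independent indeterminates), and set $t=\beta+\beta_1$, $n=\beta\beta_1$. For a positive integer $m$ let $\Psi_{m,\beta}(x)=\frac{x^m-\beta^m}{x-\beta}=\sum_{i=0}^{m-1}\beta^{m-1-i}x^i$, similarly $\Psi_{m,\beta_1}(x)$, let $p_m(x)=\Psi_{m,\beta}(x)\Psi_{m,\beta_1}(x)$, and let $a_m$ be the coefficient of $x^{m-1}$ in $p_m(x)$. Then $a_1=1$, $a_2=t$, and $a_{m+2}=ta_{m+1}-na_m$ for all $m\ge1$; moreover, for every $m\ge1$, $$p_m(x)=\sum_{i=1}^{m-1}a_ix^{2m-1-i}+a_mx^{m-1}+\sum_{i=1}^{m-1}a_{m-i}n^ix^{m-1-i},$$ where the two outer sums are interpreted as $0$ when $m=1$. -}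

module Defs where

import Data.Nat
import Relation.Nullary

open import Level using (Level)
open import Data.Nat using (ℕ; zero; suc; _∸_)
open import Algebra.Bundles using (CommutativeRing)

-- Formal polynomials over a commutative ring R, represented by their
-- coefficient sequences (coefficient of x^k at index k).
module PolyDefs {c ℓ : Level} (R : CommutativeRing c ℓ) where
  open CommutativeRing R

  pow : Carrier → ℕ → Carrier
  pow r zero    = 1#
  pow r (suc k) = r * pow r k

  sumR : ℕ → (ℕ → Carrier) → Carrier
  sumR zero    f = 0#
  sumR (suc n) f = sumR n f + f n

  sumFrom : ℕ → ℕ → (ℕ → Carrier) → Carrier
  sumFrom lo len f = sumR len (λ j → f (lo Data.Nat.+ j))

  Poly : Set c
  Poly = ℕ → Carrier

  _≈P_ : Poly → Poly → Set ℓ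
  p ≈P q = ∀ k → p k ≈ q k

  0P : Poly
  0P _ = 0#

  _+P_ : Poly → Poly → Poly
  (p +P q) k = p k + q k

  _*P_ : Poly → Poly → Poly
  (p *P q) k = sumR (suc k) (λ i → p i * q (k ∸ i))

  mono : Carrier → ℕ → Poly
  mono r d k with d Data.Nat.≟ k
  ... | Relation.Nullary.yes _ = r
  ... | Relation.Nullary.no  _ = 0#

  sumP : ℕ → ℕ → (ℕ → Poly) → Poly
  sumP lo len f k = sumFrom lo len (λ i → f i k)

  Ψ : ℕ → Carrier → Poly
  Ψ m b = sumP 0 m (λ i → mono (pow b (m ∸ 1 ∸ i)) i)

  module _ (β β₁ : Carrier) where
    t : Carrier
    t = β + β₁

    n : Carrier
    n = β * β₁

    p : ℕ → Poly
    p m = Ψ m β *P Ψ m β₁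

    a : ℕ → Carrier
    a m = p m (m ∸ 1)

    rhs : ℕ → Poly
    rhs m = (sumP 1 (m ∸ 1) (λ i → mono (a i) (2 Data.Nat.* m ∸ 1 ∸ i))
             +P mono (a m) (m ∸ 1))
            +P sumP 1 (m ∸ 1) (λ i → mono (a (m ∸ i) * pow n i) (m ∸ 1 ∸ i))

-- The coefficient of x^i in Ψ_{m,b} is b^{m-1-i} for i < m and 0 beyond, so each
-- coefficient of p_m is a sum of products β^u β₁^v over a window of indices.  Below the
-- middle degree m-1 this gives x^k ↦ n^{m-1-k} h_k, above it x^{2m-2-q} ↦ h_q, where
-- h_q = Σ_{i≤q} β^{q-i} β₁^i is the complete homogeneous polynomial.  In particular
-- a_m = h_{m-1}, so every monomial of the claimed expansion of p_m has the right
-- coefficient, and the recurrence follows from h_{q+1} = β h_q + β₁^{q+1}.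
module Submission where

open import Defs
open import Level using (Level)
open import Data.Nat using (ℕ; suc; _≤_)
open import Data.Product using (_×_; _,_)
open import Algebra.Bundles using (CommutativeRing)

open import Data.Nat as N using (zero; _<_; z≤n; s≤s; _∸_; compare; less; equal; greater)
import Data.Nat.Properties as NP
open import Data.Nat.Tactic.RingSolver using (solve-∀)
open import Relation.Binary.PropositionalEquality as P using (_≡_; _≢_)
open import Relation.Nullary using (yes; no)
open import Data.Empty using (⊥-elim)

∸-suc-injective : ∀ {o i j} → i < o → j < o → o ∸ suc i ≡ o ∸ suc j → i ≡ j
∸-suc-injective i<o j<o e = NP.suc-injective (NP.∸-cancelˡ-≡ i<o j<o e)

module _ {c ℓ : Level} (R : CommutativeRing c ℓ) where
  open CommutativeRing R
  open PolyDefs R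
  open import Algebra.Properties.Group +-group using (//-rightDividesʳ)
  open import Algebra.Solver.Ring.NaturalCoefficients.Default commutativeSemiring
  open import Relation.Binary.Reasoning.Setoid setoid

  +≈⇒≈- : ∀ {x y z} → x + y ≈ z → x ≈ z - y
  +≈⇒≈- {x} {y} {z} x+y≈z = begin
    x           ≈⟨ //-rightDividesʳ y x ⟨
    (x + y) - y ≈⟨ +-congʳ x+y≈z ⟩
    z - y       ∎

  pow-+ : ∀ b x y → pow b (x N.+ y) ≈ pow b x * pow b y
  pow-+ b zero    y = sym (*-identityˡ _)
  pow-+ b (suc x) y = trans (*-congˡ (pow-+ b x y)) (sym (*-assoc _ _ _))

  pow-* : ∀ x y r → pow (x * y) r ≈ pow x r * pow y r
  pow-* x y zero    = sym (*-identityʳ 1#)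
  pow-* x y (suc r) = trans (*-congˡ (pow-* x y r))
    (solve 4 (λ x y u v → (x :* y) :* (u :* v) := (x :* u) :* (y :* v)) refl x y (pow x r) (pow y r))

  sumR-cong : ∀ len {f g : ℕ → Carrier} → (∀ i → i < len → f i ≈ g i) → sumR len f ≈ sumR len g
  sumR-cong zero      f≈g = refl
  sumR-cong (suc len) f≈g =
    +-cong (sumR-cong len (λ i i<len → f≈g i (NP.m<n⇒m<1+n i<len))) (f≈g len NP.≤-refl)

  sumR-zero : ∀ len {f : ℕ → Carrier} → (∀ i → i < len → f i ≈ 0#) → sumR len f ≈ 0#
  sumR-zero zero      f≈0 = refl
  sumR-zero (suc len) f≈0 =
    trans (+-cong (sumR-zero len (λ i i<len → f≈0 i (NP.m<n⇒m<1+n i<len))) (f≈0 len NP.≤-refl))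
          (+-identityʳ 0#)

  sumR-single : ∀ len {f : ℕ → Carrier} j → j < len → (∀ i → i < len → i ≢ j → f i ≈ 0#) →
                sumR len f ≈ f j
  sumR-single (suc len) j j<len f≈0 with j N.≟ len
  ... | yes P.refl =
    trans (+-congʳ (sumR-zero len (λ i i<len → f≈0 i (NP.m<n⇒m<1+n i<len) (NP.<⇒≢ i<len))))
          (+-identityˡ _)
  ... | no j≢len =
    trans (+-cong (sumR-single len j (NP.≤∧≢⇒< (NP.<⇒≤pred j<len) j≢len)
                                     (λ i i<len → f≈0 i (NP.m<n⇒m<1+n i<len)))
                  (f≈0 len NP.≤-refl (λ len≡j → j≢len (P.sym len≡j))))
          (+-identityʳ _)

  sumR-*ˡ : ∀ len x (f : ℕ → Carrier) → sumR len (λ i → x * f i) ≈ x * sumR len f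
  sumR-*ˡ zero      x f = sym (zeroʳ x)
  sumR-*ˡ (suc len) x f = trans (+-congʳ (sumR-*ˡ len x f)) (sym (distribˡ x _ _))

  sumR-+ : ∀ l m (f : ℕ → Carrier) → sumR (l N.+ m) f ≈ sumR l f + sumR m (λ i → f (l N.+ i))
  sumR-+ l zero    f rewrite NP.+-identityʳ l = sym (+-identityʳ _)
  sumR-+ l (suc m) f rewrite NP.+-suc l m = trans (+-congʳ (sumR-+ l m f)) (+-assoc _ _ _)

  mono-diag : ∀ x d → mono x d d ≈ x
  mono-diag x d with d N.≟ d
  ... | yes _   = refl
  ... | no d≢d  = ⊥-elim (d≢d P.refl)

  mono-off : ∀ x {d k} → d ≢ k → mono x d k ≈ 0#
  mono-off x {d} {k} d≢k with d N.≟ k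
  ... | yes d≡k = ⊥-elim (d≢k d≡k)
  ... | no _    = refl

  sumR-mono-unique : ∀ len (cf : ℕ → Carrier) (deg : ℕ → ℕ) k j → j < len → deg j ≡ k →
                     (∀ i → i < len → deg i ≡ k → i ≡ j) →
                     sumR len (λ i → mono (cf i) (deg i) k) ≈ cf j
  sumR-mono-unique len cf deg k j j<len P.refl unique =
    trans (sumR-single len j j<len (λ i i<len i≢j → mono-off (cf i) (λ e → i≢j (unique i i<len e))))
          (mono-diag (cf j) (deg j))

  sumR-mono-absent : ∀ len (cf : ℕ → Carrier) (deg : ℕ → ℕ) k → (∀ i → i < len → deg i ≢ k) →
                     sumR len (λ i → mono (cf i) (deg i) k) ≈ 0#
  sumR-mono-absent len cf deg k absent = sumR-zero len (λ i i<len → mono-off (cf i) (absent i i<len))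

  Ψ-coeff : ∀ m b {i} → i ≤ m → Ψ (suc m) b i ≈ pow b (m ∸ i)
  Ψ-coeff m b {i} i≤m = sumR-mono-unique (suc m) (λ j → pow b (m ∸ j)) (λ j → j) i i (s≤s i≤m)
                                        P.refl (λ _ _ e → e)

  Ψ-coeff-beyond : ∀ m b {i} → m < i → Ψ (suc m) b i ≈ 0#
  Ψ-coeff-beyond m b {i} m<i = sumR-mono-absent (suc m) _ (λ j → j) i
    (λ { j (s≤s j≤m) → NP.<⇒≢ (NP.≤-<-trans j≤m m<i) })

  module _ (β β₁ : Carrier) where

    homog : ℕ → Carrier
    homog q = sumR (suc q) (λ i → pow β (q ∸ i) * pow β₁ i)

    homog-suc : ∀ q → homog (suc q) ≈ β * homog q + pow β₁ (suc q)
    homog-suc q = +-cong (trans (sumR-cong (suc q) shift) (sumR-*ˡ (suc q) β _))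
                         (trans (*-congʳ (reflexive (P.cong (pow β) (NP.n∸n≡0 q)))) (*-identityˡ _))
      where
      shift : ∀ i → i < suc q → pow β (suc q ∸ i) * pow β₁ i ≈ β * (pow β (q ∸ i) * pow β₁ i)
      shift i (s≤s i≤q) = trans (*-congʳ (reflexive (P.cong (pow β) (NP.+-∸-assoc 1 i≤q)))) (*-assoc _ _ _)

    homog-recurrence : ∀ q → homog (suc (suc q)) ≈ t β β₁ * homog (suc q) - n β β₁ * homog q
    homog-recurrence q = +≈⇒≈- (begin
      homog (suc (suc q)) + (β * β₁) * H
        ≈⟨ +-congʳ (homog-suc (suc q)) ⟩
      (β * homog (suc q) + β₁ * B) + (β * β₁) * H
        ≈⟨ +-congʳ (+-congʳ (*-congˡ (homog-suc q))) ⟩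
      (β * (β * H + B) + β₁ * B) + (β * β₁) * H
        ≈⟨ solve 4 (λ β β₁ H B → (β :* (β :* H :+ B) :+ β₁ :* B) :+ (β :* β₁) :* H
                                 := (β :+ β₁) :* (β :* H :+ B)) refl β β₁ H B ⟩
      (β + β₁) * (β * H + B)
        ≈⟨ *-congˡ (homog-suc q) ⟨
      (β + β₁) * homog (suc q) ∎)
      where
      H B : Carrier
      H = homog q
      B = pow β₁ (suc q)

    p-coeff-below : ∀ r k → p β β₁ (suc (r N.+ k)) k ≈ pow (n β β₁) r * homog k
    p-coeff-below r k = trans (sumR-cong (suc k) term) (sumR-*ˡ (suc k) (pow (n β β₁) r) _)
      where
      term : ∀ i → i < suc k → Ψ (suc (r N.+ k)) β i * Ψ (suc (r N.+ k)) β₁ (k ∸ i)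
                               ≈ pow (n β β₁) r * (pow β (k ∸ i) * pow β₁ i)
      term i (s≤s i≤k) = begin
        Ψ (suc (r N.+ k)) β i * Ψ (suc (r N.+ k)) β₁ (k ∸ i)
          ≈⟨ *-cong (Ψ-coeff (r N.+ k) β (NP.≤-trans i≤k (NP.m≤n+m k r)))
                    (Ψ-coeff (r N.+ k) β₁ (NP.≤-trans (NP.m∸n≤m k i) (NP.m≤n+m k r))) ⟩
        pow β (r N.+ k ∸ i) * pow β₁ (r N.+ k ∸ (k ∸ i))
          ≈⟨ *-cong (reflexive (P.cong (pow β) (NP.+-∸-assoc r i≤k)))
                    (reflexive (P.cong (pow β₁) (P.trans (NP.+-∸-assoc r (NP.m∸n≤m k i))
                                                   (P.cong (r N.+_) (NP.m∸[m∸n]≡n i≤k))))) ⟩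
        pow β (r N.+ (k ∸ i)) * pow β₁ (r N.+ i)
          ≈⟨ *-cong (pow-+ β r (k ∸ i)) (pow-+ β₁ r i) ⟩
        (pow β r * pow β (k ∸ i)) * (pow β₁ r * pow β₁ i)
          ≈⟨ solve 4 (λ u v x y → (u :* x) :* (v :* y) := (u :* v) :* (x :* y))
                     refl (pow β r) (pow β₁ r) (pow β (k ∸ i)) (pow β₁ i) ⟩
        (pow β r * pow β₁ r) * (pow β (k ∸ i) * pow β₁ i)
          ≈⟨ *-congʳ (pow-* β β₁ r) ⟨
        pow (n β β₁) r * (pow β (k ∸ i) * pow β₁ i) ∎

    a≈homog : ∀ q → a β β₁ (suc q) ≈ homog q
    a≈homog q = trans (p-coeff-below 0 q) (*-identityˡ _)

    a-one : a β β₁ 1 ≈ 1#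
    a-one = trans (a≈homog 0) (trans (+-identityˡ _) (*-identityˡ _))

    a-two : a β β₁ 2 ≈ t β β₁
    a-two = trans (a≈homog 1) (+-cong (trans (+-identityˡ _) (trans (*-identityʳ _) (*-identityʳ _)))
                                      (trans (*-identityˡ _) (*-identityʳ _)))

    a-recurrence : ∀ q → a β β₁ (suc (suc (suc q)))
                         ≈ t β β₁ * a β β₁ (suc (suc q)) - n β β₁ * a β β₁ (suc q)
    a-recurrence q = begin
      a β β₁ (suc (suc (suc q)))
        ≈⟨ a≈homog (suc (suc q)) ⟩
      homog (suc (suc q))
        ≈⟨ homog-recurrence q ⟩
      t β β₁ * homog (suc q) - n β β₁ * homog q
        ≈⟨ +-cong (*-congˡ (a≈homog (suc q))) (-‿cong (*-congˡ (a≈homog q))) ⟨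
      t β β₁ * a β β₁ (suc (suc q)) - n β β₁ * a β β₁ (suc q) ∎

    p-coeff-above : ∀ m j → p β β₁ (suc m) (suc (m N.+ j))
                            ≈ sumR (suc m) (λ l → Ψ (suc m) β (suc j N.+ l) * pow β₁ l)
    p-coeff-above m j = begin
      sumR (suc (suc (m N.+ j))) F
        ≈⟨ reflexive (P.cong (λ len → sumR len F) length-split) ⟩
      sumR (suc j N.+ suc m) F
        ≈⟨ sumR-+ (suc j) (suc m) F ⟩
      sumR (suc j) F + sumR (suc m) (λ l → F (suc j N.+ l))
        ≈⟨ +-cong (sumR-zero (suc j) F-low) (sumR-cong (suc m) F-high) ⟩
      0# + sumR (suc m) (λ l → Ψ (suc m) β (suc j N.+ l) * pow β₁ l)
        ≈⟨ +-identityˡ _ ⟩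
      sumR (suc m) (λ l → Ψ (suc m) β (suc j N.+ l) * pow β₁ l) ∎
      where
      F : ℕ → Carrier
      F i = Ψ (suc m) β i * Ψ (suc m) β₁ (suc (m N.+ j) ∸ i)
      length-split : suc (suc (m N.+ j)) ≡ suc j N.+ suc m
      length-split = P.cong suc (P.trans (P.cong suc (NP.+-comm m j)) (P.sym (NP.+-suc j m)))
      F-low : ∀ i → i < suc j → F i ≈ 0#
      F-low i (s≤s i≤j) = trans (*-congˡ (Ψ-coeff-beyond m β₁
          (P.subst (m <_) (P.sym (NP.+-∸-assoc (suc m) i≤j)) (s≤s (NP.m≤m+n m (j ∸ i))))))
        (zeroʳ _)
      F-high : ∀ l → l < suc m → F (suc j N.+ l) ≈ Ψ (suc m) β (suc j N.+ l) * pow β₁ l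
      F-high l (s≤s l≤m) = *-congˡ (begin
        Ψ (suc m) β₁ (m N.+ j ∸ (j N.+ l))
          ≈⟨ reflexive (P.cong (Ψ (suc m) β₁)
                   (P.trans (P.cong (_∸ (j N.+ l)) (NP.+-comm m j)) (NP.[m+n]∸[m+o]≡n∸o j m l))) ⟩
        Ψ (suc m) β₁ (m ∸ l)
          ≈⟨ Ψ-coeff m β₁ (NP.m∸n≤m m l) ⟩
        pow β₁ (m ∸ (m ∸ l))
          ≈⟨ reflexive (P.cong (pow β₁) (NP.m∸[m∸n]≡n l≤m)) ⟩
        pow β₁ l ∎)

    p-coeff-upper : ∀ j r → p β β₁ (suc (suc (j N.+ r))) (suc (suc (j N.+ r) N.+ j)) ≈ homog r
    p-coeff-upper j r = begin
      p β β₁ (suc m) (suc (m N.+ j))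
        ≈⟨ p-coeff-above m j ⟩
      sumR (suc m) G
        ≈⟨ reflexive (P.cong (λ len → sumR len G) length-split) ⟩
      sumR (suc r N.+ suc j) G
        ≈⟨ sumR-+ (suc r) (suc j) G ⟩
      sumR (suc r) G + sumR (suc j) (λ l → G (suc r N.+ l))
        ≈⟨ +-cong (sumR-cong (suc r) G-low) (sumR-zero (suc j) G-high) ⟩
      homog r + 0#
        ≈⟨ +-identityʳ _ ⟩
      homog r ∎
      where
      m : ℕ
      m = suc (j N.+ r)
      G : ℕ → Carrier
      G l = Ψ (suc m) β (suc j N.+ l) * pow β₁ l
      length-split : suc m ≡ suc r N.+ suc j
      length-split = P.cong suc (P.trans (P.cong suc (NP.+-comm j r)) (P.sym (NP.+-suc r j)))
      G-low : ∀ l → l < suc r → G l ≈ pow β (r ∸ l) * pow β₁ l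
      G-low l (s≤s l≤r) = *-congʳ (trans (Ψ-coeff m β (s≤s (NP.+-monoʳ-≤ j l≤r)))
                                         (reflexive (P.cong (pow β) (NP.[m+n]∸[m+o]≡n∸o j r l))))
      G-high : ∀ l → l < suc j → G (suc r N.+ l) ≈ 0#
      G-high l _ = trans (*-congʳ (Ψ-coeff-beyond m β (s≤s (NP.+-monoʳ-< j (s≤s (NP.m≤m+n r l))))))
                         (zeroˡ _)

    p-coeff-beyond : ∀ m j → m ≤ j → p β β₁ (suc m) (suc (m N.+ j)) ≈ 0#
    p-coeff-beyond m j m≤j = trans (p-coeff-above m j) (sumR-zero (suc m)
      (λ l _ → trans (*-congʳ (Ψ-coeff-beyond m β (s≤s (NP.≤-trans m≤j (NP.m≤m+n j l))))) (zeroˡ _)))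

    -- rhs β β₁ (suc m) k unfolds to (upper m k + mono (a β β₁ (suc m)) m k) + lower m k,
    -- with the outer sums reindexed by i = suc j.
    upper : ℕ → ℕ → Carrier
    upper m k = sumR m (λ j → mono (a β β₁ (suc j)) (2 N.* suc m ∸ 1 ∸ suc j) k)

    lower : ℕ → ℕ → Carrier
    lower m k = sumR m (λ j → mono (a β β₁ (m ∸ j) * pow (n β β₁) (suc j)) (m ∸ suc j) k)

    rhs-coeff : ∀ m k {u v w} → upper m k ≈ u → mono (a β β₁ (suc m)) m k ≈ v → lower m k ≈ w →
                rhs β β₁ (suc m) k ≈ (u + v) + w
    rhs-coeff m k upper≈u mono≈v lower≈w = +-cong (+-cong upper≈u mono≈v) lower≈w

    upper-degree : ∀ m j → 2 N.* suc m ∸ 1 ∸ suc j ≡ m N.+ suc m ∸ suc j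
    upper-degree m j = P.cong (λ x → m N.+ suc x ∸ suc j) (NP.+-identityʳ m)

    upper-vanish : ∀ m k → k ≤ m → upper m k ≈ 0#
    upper-vanish m k k≤m = sumR-mono-absent m _ _ k
      (λ j j<m e → NP.<⇒≢ (k<degree j j<m) (P.sym (P.trans (P.sym (upper-degree m j)) e)))
      where
      k<degree : ∀ j → j < m → k < m N.+ suc m ∸ suc j
      k<degree j j<m = NP.<-≤-trans (s≤s k≤m)
        (P.subst (_≤ m N.+ suc m ∸ suc j) (NP.m+n∸m≡n m (suc m)) (NP.∸-monoʳ-≤ (m N.+ suc m) j<m))

    upper-beyond : ∀ m j → m ≤ j → upper m (suc (m N.+ j)) ≈ 0#
    upper-beyond m j m≤j = sumR-mono-absent m _ _ _
      (λ i i<m e → NP.<⇒≢ (degree<k i i<m) (P.trans (P.sym (upper-degree m i)) e))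
      where
      degree<k : ∀ i → i < m → m N.+ suc m ∸ suc i < suc (m N.+ j)
      degree<k i i<m = NP.<-≤-trans (NP.∸-monoʳ-< (s≤s z≤n) (NP.≤-trans i<m (NP.m≤m+n m (suc m))))
        (P.subst (_≤ suc (m N.+ j)) (P.sym (NP.+-suc m m)) (s≤s (NP.+-monoʳ-≤ m m≤j)))

    upper-at : ∀ j r → upper (suc (j N.+ r)) (suc (suc (j N.+ r) N.+ j)) ≈ a β β₁ (suc r)
    upper-at j r = sumR-mono-unique m _ _ k r r<m degree-r
      (λ i i<m e → ∸-suc-injective (below-o i<m) (below-o r<m)
        (P.trans (P.sym (upper-degree m i)) (P.trans e (P.trans (P.sym degree-r) (upper-degree m r)))))
      where
      m k : ℕ
      m = suc (j N.+ r)
      k = suc (m N.+ j)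
      r<m : r < m
      r<m = s≤s (NP.m≤n+m r j)
      below-o : ∀ {i} → i < m → i < m N.+ suc m
      below-o i<m = NP.≤-trans i<m (NP.m≤m+n m (suc m))
      m+[1+m]≡k+[1+r] : ∀ j r → suc (j N.+ r) N.+ suc (suc (j N.+ r))
                              ≡ suc (suc (j N.+ r) N.+ j) N.+ suc r
      m+[1+m]≡k+[1+r] = solve-∀
      degree-r : 2 N.* suc m ∸ 1 ∸ suc r ≡ k
      degree-r = P.trans (upper-degree m r)
        (P.trans (P.cong (_∸ suc r) (m+[1+m]≡k+[1+r] j r)) (NP.m+n∸n≡m k (suc r)))

    lower-vanish : ∀ m k → m ≤ k → lower m k ≈ 0#
    lower-vanish m k m≤k = sumR-mono-absent m _ _ k
      (λ j j<m → NP.<⇒≢ (NP.<-≤-trans (NP.∸-monoʳ-< (s≤s z≤n) j<m) m≤k))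

    lower-at : ∀ r k → lower (suc (r N.+ k)) k ≈ a β β₁ (suc k) * pow (n β β₁) (suc r)
    lower-at r k = trans
      (sumR-mono-unique m _ _ k r r<m degree-r
        (λ i i<m e → ∸-suc-injective i<m r<m (P.trans e (P.sym degree-r))))
      (*-congʳ (reflexive (P.cong (a β β₁) index-r)))
      where
      m : ℕ
      m = suc (r N.+ k)
      r<m : r < m
      r<m = s≤s (NP.m≤m+n r k)
      degree-r : m ∸ suc r ≡ k
      degree-r = NP.m+n∸m≡n r k
      index-r : m ∸ r ≡ suc k
      index-r = P.trans (NP.+-∸-assoc 1 (NP.m≤m+n r k)) (P.cong suc (NP.m+n∸m≡n r k))

    coeff-below : ∀ r k → p β β₁ (suc (suc (r N.+ k))) k ≈ rhs β β₁ (suc (suc (r N.+ k))) k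
    coeff-below r k = begin
      p β β₁ (suc m) k
        ≈⟨ p-coeff-below (suc r) k ⟩
      pow (n β β₁) (suc r) * homog k
        ≈⟨ *-comm _ _ ⟩
      homog k * pow (n β β₁) (suc r)
        ≈⟨ *-congʳ (a≈homog k) ⟨
      a β β₁ (suc k) * pow (n β β₁) (suc r)
        ≈⟨ +-identityˡ _ ⟨
      0# + a β β₁ (suc k) * pow (n β β₁) (suc r)
        ≈⟨ +-congʳ (+-identityʳ 0#) ⟨
      (0# + 0#) + a β β₁ (suc k) * pow (n β β₁) (suc r)
        ≈⟨ rhs-coeff m k (upper-vanish m k k≤m) (mono-off _ (λ m≡k → NP.<⇒≢ k<m (P.sym m≡k)))
                         (lower-at r k) ⟨
      rhs β β₁ (suc m) k ∎
      where
      m : ℕ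
      m = suc (r N.+ k)
      k<m : k < m
      k<m = s≤s (NP.m≤n+m k r)
      k≤m : k ≤ m
      k≤m = NP.<⇒≤ k<m

    coeff-diagonal : ∀ m → p β β₁ (suc m) m ≈ rhs β β₁ (suc m) m
    coeff-diagonal m = sym (trans
      (rhs-coeff m m (upper-vanish m m NP.≤-refl) (mono-diag _ m) (lower-vanish m m NP.≤-refl))
      (trans (+-identityʳ _) (+-identityˡ _)))

    rhs-coeff-above : ∀ m j {u} → upper m (suc (m N.+ j)) ≈ u → rhs β β₁ (suc m) (suc (m N.+ j)) ≈ u
    rhs-coeff-above m j {u} upper≈u = begin
      rhs β β₁ (suc m) k
        ≈⟨ rhs-coeff m k upper≈u (mono-off _ (NP.<⇒≢ m<k)) (lower-vanish m k (NP.<⇒≤ m<k)) ⟩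
      (u + 0#) + 0#
        ≈⟨ trans (+-identityʳ _) (+-identityʳ _) ⟩
      u ∎
      where
      k : ℕ
      k = suc (m N.+ j)
      m<k : m < k
      m<k = s≤s (NP.m≤m+n m j)

    coeff-upper : ∀ j r → p β β₁ (suc (suc (j N.+ r))) (suc (suc (j N.+ r) N.+ j))
                          ≈ rhs β β₁ (suc (suc (j N.+ r))) (suc (suc (j N.+ r) N.+ j))
    coeff-upper j r = trans (trans (p-coeff-upper j r) (sym (a≈homog r)))
                            (sym (rhs-coeff-above (suc (j N.+ r)) j (upper-at j r)))

    coeff-beyond : ∀ m j → m ≤ j → p β β₁ (suc m) (suc (m N.+ j)) ≈ rhs β β₁ (suc m) (suc (m N.+ j))
    coeff-beyond m j m≤j = trans (p-coeff-beyond m j m≤j) (sym (rhs-coeff-above m j (upper-beyond m j m≤j)))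

    p≈rhs : ∀ m → p β β₁ (suc m) ≈P rhs β β₁ (suc m)
    p≈rhs m k with compare k m
    ... | less _ r    = P.subst (λ i → p β β₁ (suc (suc i)) k ≈ rhs β β₁ (suc (suc i)) k)
                                (NP.+-comm r k) (coeff-below r k)
    ... | equal _     = coeff-diagonal m
    ... | greater _ j with compare j m
    ...   | less _ r    = coeff-upper j r
    ...   | equal _     = coeff-beyond m m NP.≤-refl
    ...   | greater _ x = coeff-beyond m j (NP.≤-trans (NP.m≤m+n m x) (NP.n≤1+n _))

theorem3p2 : ∀ {c ℓ : Level} (R : CommutativeRing c ℓ) →
    let open CommutativeRing R
        open PolyDefs R
    in (β β₁ : Carrier) →
       (a β β₁ 1 ≈ 1#)
       × (a β β₁ 2 ≈ t β β₁)
       × (∀ (m : ℕ) → 1 ≤ m →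
            a β β₁ (suc (suc m)) ≈ t β β₁ * a β β₁ (suc m) - n β β₁ * a β β₁ m)
       × (∀ (m : ℕ) → 1 ≤ m → p β β₁ m ≈P rhs β β₁ m)
theorem3p2 R β β₁ =
    a-one R β β₁
  , a-two R β β₁
  , (λ { (suc q) _ → a-recurrence R β β₁ q })
  , (λ { (suc m) _ → p≈rhs R β β₁ m })
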